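{- For every dialogue tree $d\in\mathcal{D}_{\mathbb N}\mathbb{N}$, the number $\mathsf{modulusUni}(\mathsf{prune}\,d)$ is a modulus of uniform continuity of $\mathsf{dialogue}(\mathsf{prune}\,d):(\mathbb{N}\to\mathbb{B})\to\mathbb{N}$: for all $\alpha,\beta:\mathbb{N}\to\mathbb{B}$, if $\alpha(i)=\beta(i)$ for all $i<\mathsf{modulusUni}(\mathsf{prune}\,d)$, then $\mathsf{dialogue}(\mathsf{prune}\,d)\,\alpha=\mathsf{dialogue}(\mathsf{prune}\,d)\,\beta$.
   Context: $\mathbb{B}$ is the booleans; $\mathsf{emb}:\mathbb{B}\to\mathbb{N}$ maps $\mathsf{false}\mapsto0$, $\mathsf{true}\mapsto1$. Dialogue trees $\mathcal{D}(I,O,X)$: inductive type with constructors $\eta\,x$ ($x:X$) and $\beta\,\varphi\,i$ ($\varphi:O\to\mathcal{D}(I,O,X)$, $i:I$); $\mathcal{D}_{\mathbb N}\mathbb{N}:=\mathcal{D}(\mathbb{N},\mathbb{N},\mathbb{N})$. $\mathsf{dialogue}(\eta\,x)\,\alpha=x$, $\mathsf{dialogue}(\beta\,\varphi\,i)\,\alpha=\mathsf{dialogue}(\varphi(\alpha\,i))\,\alpha$. $\mathsf{prune}:\mathcal{D}_{\mathbb N}\mathbb{N}\to\mathcal{D}(\mathbb{N},\mathbb{B},\mathbb{N})$: $\mathsf{prune}(\eta\,n)=\eta\,n$, $\mathsf{prune}(\beta\,\varphi\,n)=\beta\,(\mathsf{prune}\circ\varphi\circ\mathsf{emb})\,n$.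 $\mathsf{maxBQ}(\eta\,n)=0$, $\mathsf{maxBQ}(\beta\,\varphi\,n)=\max(n,\max(\mathsf{maxBQ}(\varphi\,\mathsf{false}),\mathsf{maxBQ}(\varphi\,\mathsf{true})))$; $\mathsf{modulusUni}\,d':=1+\mathsf{maxBQ}\,d'$. The metatheory is constructive type theory. -}

module Defs where

open import Data.Bool using (Bool; false; true)
open import Data.Nat using (ℕ; zero; suc; _⊔_)

emb : Bool → ℕ
emb false = 0
emb true  = 1

data D (I O X : Set) : Set where
  η : X → D I O X
  β : (O → D I O X) → I → D I O X

Dℕℕ : Set
Dℕℕ = D ℕ ℕ ℕ

dialogue : {I O X : Set} → D I O X → (I → O) → X
dialogue (η x)   α = x
dialogue (β φ i) α = dialogue (φ (α i)) α

prune : Dℕℕ → D ℕ Bool ℕ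
prune (η n)   = η n
prune (β φ n) = β (λ b → prune (φ (emb b))) n

maxBQ : D ℕ Bool ℕ → ℕ
maxBQ (η n)   = 0
maxBQ (β φ n) = n ⊔ (maxBQ (φ false) ⊔ maxBQ (φ true))

modulusUni : D ℕ Bool ℕ → ℕ
modulusUni d' = suc (maxBQ d')

module Submission where

open import Defs
open import Data.Bool using (Bool; false; true)
open import Data.Nat using (ℕ; _<_; _≤_; s≤s; _⊔_)
open import Data.Nat.Properties using (m≤m⊔n; m≤n⊔m; ≤-trans)
open import Relation.Binary.PropositionalEquality using (_≡_; refl)

-- A dialogue only queries indices at most maxBQ, so sequences agreeing there
-- follow the same path to the same leaf.

maxBQ-query : ∀ (φ : Bool → D ℕ Bool ℕ) n → n ≤ maxBQ (β φ n)
maxBQ-query φ n = m≤m⊔n n _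

maxBQ-branch : ∀ (φ : Bool → D ℕ Bool ℕ) n b → maxBQ (φ b) ≤ maxBQ (β φ n)
maxBQ-branch φ n false = ≤-trans (m≤m⊔n _ _) (m≤n⊔m n _)
maxBQ-branch φ n true  = ≤-trans (m≤n⊔m _ _) (m≤n⊔m n _)

dialogue-cong-≤maxBQ : (t : D ℕ Bool ℕ) (α γ : ℕ → Bool)
  → (∀ i → i ≤ maxBQ t → α i ≡ γ i)
  → dialogue t α ≡ dialogue t γ
dialogue-cong-≤maxBQ (η x)   α γ agree = refl
dialogue-cong-≤maxBQ (β φ n) α γ agree
  with α n | γ n | agree n (maxBQ-query φ n)
... | b | .b | refl =
  dialogue-cong-≤maxBQ (φ b) α γ (λ i i≤ → agree i (≤-trans i≤ (maxBQ-branch φ n b)))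

dialogue-cong-<modulusUni : (t : D ℕ Bool ℕ) (α γ : ℕ → Bool)
  → (∀ i → i < modulusUni t → α i ≡ γ i)
  → dialogue t α ≡ dialogue t γ
dialogue-cong-<modulusUni t α γ agree =
  dialogue-cong-≤maxBQ t α γ (λ i i≤ → agree i (s≤s i≤))

lemma53 : (d : Dℕℕ) (α β : ℕ → Bool)
    → (∀ i → i < modulusUni (prune d) → α i ≡ β i)
    → dialogue (prune d) α ≡ dialogue (prune d) β
lemma53 d = dialogue-cong-<modulusUni (prune d)
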